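{- Among all flattened permutations of length $n$, the permutation $1\,n\,2\,(n-1)\,3\,(n-2)\cdots$ (alternately taking the smallest and largest remaining letters, starting with $1$) has the maximum number of occurrences of the pattern 13-2. Consequently, any flattened permutation having $r\ge1$ occurrences of the pattern 13-2 has length at least $1+2\sqrt r$.
   Context: The standard cycle form of a permutation $\sigma$ of $\{1,\dots,n\}$ writes $\sigma$ as a product of disjoint cycles (fixed points included as 1-cycles), each cycle written starting with its smallest letter, the cycles arranged in increasing order of their smallest letters. $\mathrm{Flatten}(\sigma)$ is the word obtained by erasing the parentheses of the standard cycle form; a flattened permutation of length $n$ is a word of the form $\mathrm{Flatten}(\sigma)$ for some permutation $\sigma$ of $\{1,\dots,n\}$. An occurrence of the pattern 13-2 in a word $w_1\cdots w_n$ is a pair of indices $(i,j)$ with $2\le i<j\le n$ and $w_{i-1}<w_j<w_i$. -}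

module Defs where

open import Data.Nat using (ℕ; zero; suc; _+_; _∸_; _<ᵇ_)
open import Data.Bool using (Bool; true; false; _∧_; if_then_else_)
open import Data.Fin using (Fin; toℕ) renaming (_≟_ to _≟ᶠ_)
open import Data.Fin.Permutation using (Permutation′; _⟨$⟩ʳ_)
open import Data.List using (List; []; _∷_; _++_; map; foldl; allFin)
open import Data.Bool.ListAction using (any)
open import Data.Product using (∃)
open import Relation.Nullary.Decidable using (does)
open import Relation.Binary.PropositionalEquality using (_≡_)

-- Letters of {1,…,n} are represented by Fin n, the letter i being toℕ i + 1.

-- The cycle of σ through a, listed a, σ a, σ² a, … until returning to a.
-- (fuel n suffices since every cycle has length ≤ n)
cycleFrom : ∀ {n} → Permutation′ n → ℕ → Fin n → Fin n → List (Fin n)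
cycleFrom σ zero    a x = []
cycleFrom σ (suc k) a x =
  x ∷ (if does ((σ ⟨$⟩ʳ x) ≟ᶠ a) then [] else cycleFrom σ k a (σ ⟨$⟩ʳ x))

_∈ᵇ_ : ∀ {n} → Fin n → List (Fin n) → Bool
a ∈ᵇ xs = any (λ y → does (a ≟ᶠ y)) xs

-- Standard cycle form with parentheses erased: scan letters in increasing
-- order; each letter not yet written is the smallest letter of a new cycle,
-- which is written starting from that letter.
flattenFin : ∀ {n} → Permutation′ n → List (Fin n)
flattenFin {n} σ = foldl step [] (allFin n)
  where
  step : List (Fin n) → Fin n → List (Fin n)
  step acc a = if a ∈ᵇ acc then acc else acc ++ cycleFrom σ n a a

Flatten : ∀ {n} → Permutation′ n → List ℕ
Flatten σ = map (λ i → suc (toℕ i)) (flattenFin σ)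

IsFlattened : ℕ → List ℕ → Set
IsFlattened n w = ∃ λ (σ : Permutation′ n) → Flatten σ ≡ w

countBetween : ℕ → ℕ → List ℕ → ℕ
countBetween a b []       = 0
countBetween a b (c ∷ cs) =
  (if (a <ᵇ c) ∧ (c <ᵇ b) then 1 else 0) + countBetween a b cs

-- number of occurrences of 13-2: pairs (i,j), 2 ≤ i < j, w_{i-1} < w_j < w_i.
-- For each adjacent pair (w_{i-1}, w_i) count the later letters w_j (j > i).
occ13-2 : List ℕ → ℕ
occ13-2 []            = 0
occ13-2 (a ∷ [])      = 0
occ13-2 (a ∷ b ∷ rest) = countBetween a b rest + occ13-2 (b ∷ rest)

mutual
  zig : ℕ → ℕ → ℕ → List ℕ
  zig zero    lo hi = []
  zig (suc k) lo hi = lo ∷ zag k (suc lo) hi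

  zag : ℕ → ℕ → ℕ → List ℕ
  zag zero    lo hi = []
  zag (suc k) lo hi = hi ∷ zig k lo (hi ∸ 1)

zigzag : ℕ → List ℕ
zigzag n = zig n 1 n

-- Appending a letter z to a word creates one occurrence of 13-2 for each adjacent ascent a b
-- of the word with a < z < b. Two such ascents cannot share a letter, so appending to a word of
-- length L creates at most ⌊L/2⌋ occurrences, and a word of length L has at most
-- maxOcc L = Σ_{i<L} ⌊i/2⌋ = ⌊(L−1)²/4⌋ of them. A flattened permutation of {1,…,n} repeats no
-- letter, so it has at most n letters. The zigzag attains maxOcc n: its first two letters 1 n
-- straddle all later letters, the letter n creates nothing, and what remains is a zigzag on
-- {2,…,n−1}. Finally, the zigzag is the flattening of the single cycle (1 n 2 (n−1) ⋯).

module Submission where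

open import Defs
open import Data.Bool using (true; false; _∧_; if_then_else_; T)
open import Data.Bool.Properties using (T-≡)
open import Data.Nat
open import Data.Nat.Properties
open import Data.Nat.Solver using (module +-*-Solver)
open import Data.Fin using (Fin; toℕ; zero; suc; inject₁; opposite) renaming (_≟_ to _≟ᶠ_)
open import Data.Fin.Properties using (pigeonhole; toℕ<n; opposite-prop; opposite-involutive)
open import Data.Fin.Permutation
  using (Permutation′; _⟨$⟩ʳ_; _⟨$⟩ˡ_; inverseˡ; inverseʳ; id; flip; _∘ₚ_; reverse; lift₀)
open import Data.List using (List; []; _∷_; _++_; _∷ʳ_; length; foldl; allFin; lookup; tabulate; map)
open import Data.List.Properties
  using (length-++; length-map; tabulate-cong; map-tabulate; map-cong-local; map-∘)
open import Data.List.Reverse using (Reverse; []; _∶_∶ʳ_; reverseView)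
open import Data.List.Membership.Propositional using (_∈_; _∉_)
open import Data.List.Membership.Propositional.Properties
  using (∈-lookup; ∈-++⁻; ∈-++⁺ˡ; ∈-++⁺ʳ; ∈-tabulate⁺)
open import Data.List.Relation.Unary.All as All using (All; []; _∷_)
import Data.List.Relation.Unary.All.Properties as Allₚ
open import Data.List.Relation.Unary.Any as Any using (here; there)
open import Data.List.Relation.Unary.Any.Properties using (any⁺)
open import Data.List.Relation.Unary.AllPairs using ([]; _∷_)
open import Data.List.Relation.Unary.Unique.Propositional using (Unique)
open import Data.List.Relation.Unary.Unique.Propositional.Properties using (++⁺)
open import Data.Product using (_×_; _,_; proj₁; ∃-syntax)
open import Data.Sum using (_⊎_; inj₁; inj₂)
open import Function.Base using (_∘_)
open import Function.Bundles using (Equivalence; Injection)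
open import Function.Properties.Inverse using (Inverse⇒Injection)
open import Relation.Nullary using (yes; no; ¬_; contradiction)
open import Relation.Nullary.Decidable using (dec-true)
open import Relation.Binary.PropositionalEquality

-- Occurrences of 13-2 in a word of given length

<ᵇ-true : ∀ {m n} → m < n → (m <ᵇ n) ≡ true
<ᵇ-true m<n = Equivalence.to T-≡ (<⇒<ᵇ m<n)

<ᵇ≡true⇒< : ∀ {m n} → (m <ᵇ n) ≡ true → m < n
<ᵇ≡true⇒< {m} {n} eq = <ᵇ⇒< m n (Equivalence.from T-≡ eq)

<ᵇ-false : ∀ {m n} → n ≤ m → (m <ᵇ n) ≡ false
<ᵇ-false {m} {n} n≤m with m <ᵇ n in eq
... | false = refl
... | true  = contradiction (<ᵇ≡true⇒< eq) (≤⇒≯ n≤m)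

between : ℕ → ℕ → ℕ → ℕ
between a b c = if (a <ᵇ c) ∧ (c <ᵇ b) then 1 else 0

between-≡0 : ∀ {a b} c → b ≤ a → between a b c ≡ 0
between-≡0 {a} {b} c b≤a with a <ᵇ c in eq
... | false = refl
... | true rewrite <ᵇ-false {c} {b} (≤-trans b≤a (<⇒≤ (<ᵇ≡true⇒< eq))) = refl

countBetween-++ : ∀ a b xs ys →
  countBetween a b (xs ++ ys) ≡ countBetween a b xs + countBetween a b ys
countBetween-++ a b []       ys = refl
countBetween-++ a b (c ∷ xs) ys = begin
  between a b c + countBetween a b (xs ++ ys)
    ≡⟨ cong (between a b c +_) (countBetween-++ a b xs ys) ⟩
  between a b c + (countBetween a b xs + countBetween a b ys)
    ≡⟨ +-assoc (between a b c) _ _ ⟨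
  between a b c + countBetween a b xs + countBetween a b ys ∎
  where open ≡-Reasoning

countBetween-all : ∀ {a b} xs → All (λ c → a < c × c < b) xs → countBetween a b xs ≡ length xs
countBetween-all []       []              = refl
countBetween-all (c ∷ xs) ((a<c , c<b) ∷ h)
  rewrite <ᵇ-true a<c | <ᵇ-true c<b = cong suc (countBetween-all xs h)

countBetween-≡0 : ∀ {a b} xs → b ≤ a → countBetween a b xs ≡ 0
countBetween-≡0 []       b≤a = refl
countBetween-≡0 (c ∷ xs) b≤a rewrite between-≡0 c b≤a = countBetween-≡0 xs b≤a

straddles : List ℕ → ℕ → ℕ
straddles (a ∷ b ∷ r) z = between a b z + straddles (b ∷ r) z
straddles _           z = 0

occ13-2-∷ʳ : ∀ w z → occ13-2 (w ∷ʳ z) ≡ occ13-2 w + straddles w z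
occ13-2-∷ʳ []          z = refl
occ13-2-∷ʳ (a ∷ [])    z = refl
occ13-2-∷ʳ (a ∷ b ∷ r) z = begin
  countBetween a b (r ∷ʳ z) + occ13-2 (b ∷ r ∷ʳ z)
    ≡⟨ cong₂ _+_ (countBetween-++ a b r (z ∷ [])) (occ13-2-∷ʳ (b ∷ r) z) ⟩
  (countBetween a b r + (between a b z + 0)) + (occ13-2 (b ∷ r) + straddles (b ∷ r) z)
    ≡⟨ solve 4 (λ p q r s → (p :+ (q :+ con 0)) :+ (r :+ s) := (p :+ r) :+ (q :+ s))
             refl (countBetween a b r) (between a b z) _ _ ⟩
  occ13-2 (a ∷ b ∷ r) + straddles (a ∷ b ∷ r) z ∎
  where open ≡-Reasoning
        open +-*-Solver

straddles-∷-skip : ∀ {z b} r → z < b → straddles (b ∷ r) z ≡ straddles r z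
straddles-∷-skip []      z<b = refl
straddles-∷-skip (c ∷ r) z<b rewrite <ᵇ-false (<⇒≤ z<b) = refl

straddles-≤-half : ∀ w z → straddles w z ≤ ⌊ length w /2⌋
straddles-≤-half []      z = z≤n
straddles-≤-half (a ∷ w) z = go a w
  where
  go : ∀ a w → straddles (a ∷ w) z ≤ ⌊ suc (length w) /2⌋
  go a []      = z≤n
  go a (b ∷ r) with a <ᵇ z
  ... | false = ≤-trans (go b r) (⌊n/2⌋-mono (n≤1+n _))
  ... | true with z <ᵇ b in z<ᵇb
  ...   | false = ≤-trans (go b r) (⌊n/2⌋-mono (n≤1+n _))
  ...   | true rewrite straddles-∷-skip {z} {b} r (<ᵇ≡true⇒< z<ᵇb) =
    s≤s (straddles-≤-half r z)

maxOcc : ℕ → ℕ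
maxOcc zero    = 0
maxOcc (suc n) = maxOcc n + ⌊ n /2⌋

occ13-2-≤-maxOcc : ∀ w → occ13-2 w ≤ maxOcc (length w)
occ13-2-≤-maxOcc w = go (reverseView w)
  where
  go : ∀ {w} → Reverse w → occ13-2 w ≤ maxOcc (length w)
  go []              = z≤n
  go (xs ∶ rs ∶ʳ z) rewrite occ13-2-∷ʳ xs z | length-++ xs {z ∷ []} | +-comm (length xs) 1 =
    +-mono-≤ (go rs) (straddles-≤-half xs z)

maxOcc-≤-+ : ∀ m k → maxOcc m ≤ maxOcc (k + m)
maxOcc-≤-+ m zero    = ≤-refl
maxOcc-≤-+ m (suc k) = ≤-trans (maxOcc-≤-+ m k) (m≤m+n _ _)

maxOcc-mono : ∀ {m n} → m ≤ n → maxOcc m ≤ maxOcc n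
maxOcc-mono {m} {n} m≤n =
  subst (λ k → maxOcc m ≤ maxOcc k) (m∸n+n≡m m≤n) (maxOcc-≤-+ m (n ∸ m))

maxOcc-suc-suc : ∀ n → maxOcc (suc (suc n)) ≡ maxOcc n + n
maxOcc-suc-suc n = trans (+-assoc (maxOcc n) _ _) (cong (maxOcc n +_) (⌊n/2⌋+⌈n/2⌉≡n n))

maxOcc-≤-quarterSquare : ∀ n → 4 * maxOcc n ≤ (n ∸ 1) * (n ∸ 1)
maxOcc-≤-quarterSquare 0 = z≤n
maxOcc-≤-quarterSquare 1 = z≤n
maxOcc-≤-quarterSquare 2 = z≤n
maxOcc-≤-quarterSquare (suc (suc (suc m))) = begin
  4 * maxOcc (3 + m)             ≡⟨ cong (4 *_) (maxOcc-suc-suc (suc m)) ⟩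
  4 * (maxOcc (1 + m) + suc m)   ≡⟨ *-distribˡ-+ 4 (maxOcc (suc m)) (suc m) ⟩
  4 * maxOcc (1 + m) + 4 * suc m ≤⟨ +-monoˡ-≤ (4 * suc m) (maxOcc-≤-quarterSquare (suc m)) ⟩
  m * m + 4 * suc m              ≡⟨ square-step m ⟩
  (2 + m) * (2 + m)              ∎
  where
  open ≤-Reasoning
  square-step : ∀ m → m * m + 4 * suc m ≡ (2 + m) * (2 + m)
  square-step = solve 1 (λ m → m :* m :+ con 4 :* (con 1 :+ m) := (con 2 :+ m) :* (con 2 :+ m)) refl
    where open +-*-Solver

-- The zigzag attains the bound

occ13-2-∷-≥ : ∀ {b} w → All (_≤ b) w → occ13-2 (b ∷ w) ≡ occ13-2 w
occ13-2-∷-≥ []      []          = refl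
occ13-2-∷-≥ (c ∷ r) (c≤b ∷ _) = cong (_+ occ13-2 (c ∷ r)) (countBetween-≡0 r c≤b)

shrink-interval : ∀ {lo k hi} → lo + suc k ≤ suc hi → lo + k ≤ hi
shrink-interval {lo} {k} {hi} p = ≤-pred (subst (_≤ suc hi) (+-suc lo k) p)

mutual
  zig-range : ∀ k lo hi → lo + k ≤ suc hi → All (λ c → lo ≤ c × c ≤ hi) (zig k lo hi)
  zig-range zero    lo hi p = []
  zig-range (suc k) lo hi p =
    (≤-refl , ≤-trans (m≤m+n lo k) (shrink-interval p))
    ∷ All.map (λ (lo<c , c≤hi) → <⇒≤ lo<c , c≤hi)
              (zag-range k (suc lo) hi (s≤s (shrink-interval p)))

  zag-range : ∀ k lo hi → lo + k ≤ suc hi → All (λ c → lo ≤ c × c ≤ hi) (zag k lo hi)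
  zag-range zero    lo hi p = []
  zag-range (suc k) lo hi p =
    (≤-trans (m≤m+n lo k) (shrink-interval p) , ≤-refl)
    ∷ All.map (λ (lo≤c , c≤hi-1) → lo≤c , ≤-trans c≤hi-1 (m∸n≤m hi 1))
              (zig-range k lo (hi ∸ 1) (≤-trans (shrink-interval p) (m≤n+m∸n hi 1)))

mutual
  zig-length : ∀ k lo hi → length (zig k lo hi) ≡ k
  zig-length zero    lo hi = refl
  zig-length (suc k) lo hi = cong suc (zag-length k (suc lo) hi)

  zag-length : ∀ k lo hi → length (zag k lo hi) ≡ k
  zag-length zero    lo hi = refl
  zag-length (suc k) lo hi = cong suc (zig-length k lo (hi ∸ 1))

occ13-2-zig : ∀ k lo hi → lo + k ≤ suc hi → occ13-2 (zig k lo hi) ≡ maxOcc k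
occ13-2-zig zero          lo hi p = refl
occ13-2-zig (suc zero)    lo hi p = refl
occ13-2-zig (suc (suc k)) lo hi p = begin
  countBetween lo hi rest + occ13-2 (hi ∷ rest)
    ≡⟨ cong₂ _+_ straddled (occ13-2-∷-≥ rest (All.map (λ (_ , c≤hi-1) → <⇒≤ (<hi c≤hi-1)) rest-range))
    ⟩
  k + occ13-2 rest
    ≡⟨ cong (k +_) (occ13-2-zig k (suc lo) (hi ∸ 1) rest-fits) ⟩
  k + maxOcc k
    ≡⟨ +-comm k (maxOcc k) ⟩
  maxOcc k + k
    ≡⟨ maxOcc-suc-suc k ⟨
  maxOcc (suc (suc k)) ∎
  where
  open ≡-Reasoning
  rest = zig k (suc lo) (hi ∸ 1)
  lo+k<hi : lo + k < hi
  lo+k<hi = subst (_≤ hi) (+-suc lo k) (shrink-interval p)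
  rest-fits : suc lo + k ≤ suc (hi ∸ 1)
  rest-fits = ≤-trans lo+k<hi (m≤n+m∸n hi 1)
  rest-range : All (λ c → suc lo ≤ c × c ≤ hi ∸ 1) rest
  rest-range = zig-range k (suc lo) (hi ∸ 1) rest-fits
  <hi : ∀ {c} → c ≤ hi ∸ 1 → c < hi
  <hi c≤hi-1 = ≤-trans (s≤s c≤hi-1) (≤-reflexive (m+[n∸m]≡n (≤-trans (s≤s z≤n) lo+k<hi)))
  straddled : countBetween lo hi rest ≡ k
  straddled = trans (countBetween-all rest (All.map (λ (lo<c , c≤hi-1) → lo<c , <hi c≤hi-1) rest-range))
                    (zig-length k (suc lo) (hi ∸ 1))

occ13-2-zigzag : ∀ n → occ13-2 (zigzag n) ≡ maxOcc n
occ13-2-zigzag n = occ13-2-zig n 1 n ≤-refl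

-- A flattened permutation repeats no letter

foldl-preserves : ∀ {A B : Set} (P : A → Set) (f : A → B → A) →
  (∀ acc x → P acc → P (f acc x)) → ∀ acc xs → P acc → P (foldl f acc xs)
foldl-preserves P f pres acc []       p = p
foldl-preserves P f pres acc (x ∷ xs) p = foldl-preserves P f pres (f acc x) xs (pres acc x p)

foldl-fixed : ∀ {A B : Set} (f : A → B → A) {acc} xs →
  (∀ x → f acc x ≡ acc) → foldl f acc xs ≡ acc
foldl-fixed f []       fixed = refl
foldl-fixed f (x ∷ xs) fixed rewrite fixed x = foldl-fixed f xs fixed

lookup-injective : ∀ {A : Set} {xs : List A} → Unique xs →
  ∀ i j → lookup xs i ≡ lookup xs j → i ≡ j
lookup-injective (x∉xs ∷ u) zero    zero    e = refl
lookup-injective (x∉xs ∷ u) zero    (suc j) e = contradiction e (All.lookup x∉xs (∈-lookup j))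
lookup-injective (x∉xs ∷ u) (suc i) zero    e = contradiction (sym e) (All.lookup x∉xs (∈-lookup i))
lookup-injective (x∉xs ∷ u) (suc i) (suc j) e = cong suc (lookup-injective u i j e)

unique-length-≤ : ∀ {n} {xs : List (Fin n)} → Unique xs → length xs ≤ n
unique-length-≤ {n} {xs} u with length xs ≤? n
... | yes p  = p
... | no  ¬p with pigeonhole (≰⇒> ¬p) (lookup xs)
...   | i , j , i<j , e = contradiction (cong toℕ (lookup-injective u i j e)) (<⇒≢ i<j)

∈⇒∈ᵇ : ∀ {n} {a : Fin n} {xs} → a ∈ xs → T (a ∈ᵇ xs)
∈⇒∈ᵇ {a = a} = any⁺ _ ∘ Any.map (λ {y} a≡y → Equivalence.from T-≡ (dec-true (a ≟ᶠ y) a≡y))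

module _ {n : ℕ} (σ : Permutation′ n) where

  iter : ℕ → Fin n → Fin n
  iter zero    x = x
  iter (suc t) x = σ ⟨$⟩ʳ iter t x

  iter-+ : ∀ t u x → iter (t + u) x ≡ iter t (iter u x)
  iter-+ zero    u x = refl
  iter-+ (suc t) u x = cong (σ ⟨$⟩ʳ_) (iter-+ t u x)

  iter-suc : ∀ t x → iter (suc t) x ≡ iter t (σ ⟨$⟩ʳ x)
  iter-suc t x = trans (cong (λ m → iter m x) (+-comm 1 t)) (iter-+ t 1 x)

  iter-injective : ∀ t {x y} → iter t x ≡ iter t y → x ≡ y
  iter-injective zero    e = e
  iter-injective (suc t) e = iter-injective t (Injection.injective (Inverse⇒Injection σ) e)

  iter-∸ : ∀ {u v} x → u ≤ v → iter u x ≡ iter v x → iter (v ∸ u) x ≡ x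
  iter-∸ {u} {v} x u≤v e = iter-injective u (begin
    iter u (iter (v ∸ u) x) ≡⟨ iter-+ u (v ∸ u) x ⟨
    iter (u + (v ∸ u)) x    ≡⟨ cong (λ m → iter m x) (m+[n∸m]≡n u≤v) ⟩
    iter v x                ≡⟨ e ⟨
    iter u x                ∎)
    where open ≡-Reasoning

  period : ∀ x → ∃[ m ] 0 < m × m ≤ n × iter m x ≡ x
  period x with pigeonhole (n<1+n n) (λ i → iter (toℕ i) x)
  ... | i , j , i<j , e =
    toℕ j ∸ toℕ i , m<n⇒0<n∸m i<j , ≤-trans (m∸n≤m (toℕ j) (toℕ i)) (≤-pred (toℕ<n j)) ,
    iter-∸ x (<⇒≤ i<j) e

  iter-*-period : ∀ {m x} q → iter m x ≡ x → iter (q * m) x ≡ x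
  iter-*-period         zero    e = refl
  iter-*-period {m} {x} (suc q) e = begin
    iter (m + q * m) x      ≡⟨ iter-+ m (q * m) x ⟩
    iter m (iter (q * m) x) ≡⟨ cong (iter m) (iter-*-period q e) ⟩
    iter m x                ≡⟨ e ⟩
    x                       ∎
    where open ≡-Reasoning

  orbit-returns : ∀ x t → ∃[ s ] iter s (iter t x) ≡ x
  orbit-returns x t with period x
  ... | m@(suc _) , _ , _ , e = t * m ∸ t , (begin
    iter (t * m ∸ t) (iter t x) ≡⟨ iter-+ (t * m ∸ t) t x ⟨
    iter (t * m ∸ t + t) x      ≡⟨ cong (λ s → iter s x) (m∸n+n≡m (m≤m*n t m)) ⟩
    iter (t * m) x              ≡⟨ iter-*-period t e ⟩
    x                           ∎)
    where open ≡-Reasoning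

  module _ (a : Fin n) where

    cycleFrom-⊆-orbit : ∀ k x {y} → y ∈ cycleFrom σ k a x → ∃[ t ] y ≡ iter t x
    cycleFrom-⊆-orbit (suc k) x (here refl) = 0 , refl
    cycleFrom-⊆-orbit (suc k) x (there y∈) with σ ⟨$⟩ʳ x ≟ᶠ a
    ... | no _ with cycleFrom-⊆-orbit k (σ ⟨$⟩ʳ x) y∈
    ...   | t , refl = suc t , sym (iter-suc t x)

    cycleFrom-tabulate : ∀ {m} (g : Fin (suc m) → Fin n) →
      (∀ i → σ ⟨$⟩ʳ g (inject₁ i) ≡ g (suc i)) → (∀ i → g (suc i) ≢ a) →
      cycleFrom σ (suc m) a (g zero) ≡ tabulate g
    cycleFrom-tabulate {zero} g step avoid with σ ⟨$⟩ʳ g zero ≟ᶠ a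
    ... | yes _ = refl
    ... | no  _ = refl
    cycleFrom-tabulate {suc m} g step avoid with σ ⟨$⟩ʳ g zero ≟ᶠ a
    ... | yes σg₀≡a = contradiction (trans (sym (step zero)) σg₀≡a) (avoid zero)
    ... | no  _     = cong (g zero ∷_) (begin
      cycleFrom σ (suc m) a (σ ⟨$⟩ʳ g zero)
        ≡⟨ cong (cycleFrom σ (suc m) a) (step zero) ⟩
      cycleFrom σ (suc m) a (g (suc zero))
        ≡⟨ cycleFrom-tabulate (g ∘ suc) (step ∘ suc) (avoid ∘ suc) ⟩
      tabulate (g ∘ suc) ∎)
      where open ≡-Reasoning

    -- Enough fuel to reach a ensures that the cycle is written up to its last letter.
    cycleFrom-closed : ∀ k x → (∃[ m ] 0 < m × m ≤ k × iter m x ≡ a) →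
      ∀ {y} → y ∈ cycleFrom σ k a x → σ ⟨$⟩ʳ y ∈ cycleFrom σ k a x ⊎ σ ⟨$⟩ʳ y ≡ a
    cycleFrom-closed (suc k) x reach y∈ with σ ⟨$⟩ʳ x ≟ᶠ a
    cycleFrom-closed (suc k) x reach (here refl) | yes σx≡a = inj₂ σx≡a
    cycleFrom-closed (suc k) x (suc zero , _ , _ , σx≡a) y∈ | no σx≢a = contradiction σx≡a σx≢a
    cycleFrom-closed (suc (suc k)) x (suc (suc m) , _ , s≤s m≤k , e) (here refl) | no _ =
      inj₁ (there (here refl))
    cycleFrom-closed (suc k) x (suc (suc m) , _ , s≤s m≤k , e) (there y∈) | no _
      with cycleFrom-closed k (σ ⟨$⟩ʳ x)
                            (suc m , s≤s z≤n , m≤k , trans (sym (iter-suc (suc m) x)) e) y∈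
    ... | inj₁ σy∈ = inj₁ (there σy∈)
    ... | inj₂ σy≡a = inj₂ σy≡a

    NoReturnUpTo : ℕ → Set
    NoReturnUpTo u = ∀ t → 0 < t → t ≤ u → iter t a ≢ a

    noReturn-zero : NoReturnUpTo 0
    noReturn-zero t 0<t t≤0 = contradiction t≤0 (<⇒≱ 0<t)

    noReturn-suc : ∀ {u} → NoReturnUpTo u → iter (suc u) a ≢ a → NoReturnUpTo (suc u)
    noReturn-suc {u} h ne t 0<t t≤1+u with t ≟ suc u
    ... | yes refl = ne
    ... | no  t≢1+u = h t 0<t (≤-pred (≤∧≢⇒< t≤1+u t≢1+u))

    cycleFrom-later : ∀ k u → NoReturnUpTo u →
      All (λ y → ∃[ v ] u ≤ v × NoReturnUpTo v × y ≡ iter v a) (cycleFrom σ k a (iter u a))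
    cycleFrom-later zero    u h = []
    cycleFrom-later (suc k) u h with σ ⟨$⟩ʳ iter u a ≟ᶠ a
    ... | yes _ = (u , ≤-refl , h , refl) ∷ []
    ... | no ne = (u , ≤-refl , h , refl) ∷
      All.map (λ (v , 1+u≤v , hv , e) → v , ≤-trans (n≤1+n u) 1+u≤v , hv , e)
              (cycleFrom-later k (suc u) (noReturn-suc h ne))

    cycleFrom-unique : ∀ k u → NoReturnUpTo u → Unique (cycleFrom σ k a (iter u a))
    cycleFrom-unique zero    u h = []
    cycleFrom-unique (suc k) u h with σ ⟨$⟩ʳ iter u a ≟ᶠ a
    ... | yes _ = [] ∷ []
    ... | no ne = All.map distinct (cycleFrom-later k (suc u) h′) ∷ cycleFrom-unique k (suc u) h′
      where
      h′ = noReturn-suc h ne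
      distinct : ∀ {y} → (∃[ v ] suc u ≤ v × NoReturnUpTo v × y ≡ iter v a) → iter u a ≢ y
      distinct (v , u<v , hv , refl) e =
        hv (v ∸ u) (m<n⇒0<n∸m u<v) (m∸n≤m v u) (iter-∸ a (<⇒≤ u<v) e)

  cycleFrom-head : ∀ a k x → 0 < k → x ∈ cycleFrom σ k a x
  cycleFrom-head a (suc k) x _ = here refl

  Closed : List (Fin n) → Set
  Closed acc = ∀ {y} → y ∈ acc → σ ⟨$⟩ʳ y ∈ acc

  closed-iter : ∀ {acc} → Closed acc → ∀ t {y} → y ∈ acc → iter t y ∈ acc
  closed-iter cl zero    y∈ = y∈
  closed-iter cl (suc t) y∈ = cl (closed-iter cl t y∈)

  flattenStep : List (Fin n) → Fin n → List (Fin n)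
  flattenStep acc a = if a ∈ᵇ acc then acc else acc ++ cycleFrom σ n a a

  flattenStep-preserves : ∀ acc a → Unique acc × Closed acc →
    Unique (flattenStep acc a) × Closed (flattenStep acc a)
  flattenStep-preserves acc a (u , cl) with a ∈ᵇ acc in a∈ᵇacc
  ... | true  = u , cl
  ... | false = ++⁺ u (cycleFrom-unique a n 0 (noReturn-zero a)) disjoint , closed
    where
    C = cycleFrom σ n a a
    a∉acc : a ∉ acc
    a∉acc a∈acc = subst T a∈ᵇacc (∈⇒∈ᵇ a∈acc)
    disjoint : ∀ {y} → ¬ (y ∈ acc × y ∈ C)
    disjoint (y∈acc , y∈C) with cycleFrom-⊆-orbit a n a y∈C
    ... | t , refl with orbit-returns a t
    ...   | s , e = a∉acc (subst (_∈ acc) e (closed-iter cl s y∈acc))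
    closed : Closed (acc ++ C)
    closed y∈ with ∈-++⁻ acc y∈
    ... | inj₁ y∈acc = ∈-++⁺ˡ (cl y∈acc)
    ... | inj₂ y∈C with cycleFrom-closed a n a (period a) y∈C
    ...   | inj₁ σy∈C = ∈-++⁺ʳ acc σy∈C
    ...   | inj₂ σy≡a = ∈-++⁺ʳ acc (subst (_∈ C) (sym σy≡a) a∈C)
      where a∈C = cycleFrom-head a n a (≤-trans (s≤s z≤n) (toℕ<n a))

  flattenFin-unique : Unique (flattenFin σ)
  flattenFin-unique = proj₁ (foldl-preserves (λ acc → Unique acc × Closed acc) flattenStep
                                             flattenStep-preserves [] (allFin n) ([] , λ ()))

  flattenStep-∈ : ∀ {acc a} → a ∈ acc → flattenStep acc a ≡ acc
  flattenStep-∈ {acc} a∈acc rewrite Equivalence.to T-≡ (∈⇒∈ᵇ a∈acc) = refl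

Flatten-length-≤ : ∀ {n} (σ : Permutation′ n) → length (Flatten σ) ≤ n
Flatten-length-≤ σ =
  subst (_≤ _) (sym (length-map _ (flattenFin σ))) (unique-length-≤ (flattenFin-unique σ))

-- The zigzag is a flattened permutation

flattenFin-singleCycle : ∀ {m} (σ : Permutation′ (suc m)) →
  (∀ x → x ∈ cycleFrom σ (suc m) zero zero) → flattenFin σ ≡ cycleFrom σ (suc m) zero zero
flattenFin-singleCycle σ all∈ =
  foldl-fixed (flattenStep σ) (tabulate suc) (λ x → flattenStep-∈ σ (all∈ x))

opposite-inject₁ : ∀ {m} (i : Fin m) → opposite (inject₁ i) ≡ suc (opposite i)
opposite-inject₁ zero    = refl
opposite-inject₁ (suc i) = cong inject₁ (opposite-inject₁ i)

rotate : ∀ n → Permutation′ n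
rotate zero    = id
rotate (suc n) = reverse ∘ₚ lift₀ reverse

rotate-inject₁ : ∀ {m} (i : Fin m) → rotate (suc m) ⟨$⟩ʳ inject₁ i ≡ suc i
rotate-inject₁ i rewrite opposite-inject₁ i = cong suc (opposite-involutive i)

-- zigzagOrder n ⟨$⟩ʳ t is the t-th letter of the zigzag, counting letters from 0.
zigzagOrder : ∀ n → Permutation′ n
zigzagOrder zero    = id
zigzagOrder (suc n) = lift₀ (zigzagOrder n ∘ₚ reverse)

-- The conjugate of the rotation i ↦ i + 1 (mod n) by zigzagOrder n: it sends each letter of the
-- zigzag to the next one.
zigzagCycle : ∀ n → Permutation′ n
zigzagCycle n = flip (zigzagOrder n) ∘ₚ rotate n ∘ₚ zigzagOrder n

cycleFrom-zigzagCycle : ∀ m →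
  cycleFrom (zigzagCycle (suc m)) (suc m) zero zero ≡ tabulate (zigzagOrder (suc m) ⟨$⟩ʳ_)
cycleFrom-zigzagCycle m = cycleFrom-tabulate (zigzagCycle (suc m)) zero (ρ ⟨$⟩ʳ_) step avoid
  where
  ρ = zigzagOrder (suc m)
  step : ∀ i → zigzagCycle (suc m) ⟨$⟩ʳ (ρ ⟨$⟩ʳ inject₁ i) ≡ ρ ⟨$⟩ʳ suc i
  step i = trans (cong (λ x → ρ ⟨$⟩ʳ (rotate (suc m) ⟨$⟩ʳ x)) (inverseˡ ρ {inject₁ i}))
                 (cong (ρ ⟨$⟩ʳ_) (rotate-inject₁ i))
  avoid : ∀ i → ρ ⟨$⟩ʳ suc i ≢ zero
  avoid i ()

flattenFin-zigzagCycle : ∀ n → flattenFin (zigzagCycle n) ≡ tabulate (zigzagOrder n ⟨$⟩ʳ_)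
flattenFin-zigzagCycle zero    = refl
flattenFin-zigzagCycle (suc m) =
  trans (flattenFin-singleCycle (zigzagCycle (suc m)) all∈) (cycleFrom-zigzagCycle m)
  where
  all∈ : ∀ x → x ∈ cycleFrom (zigzagCycle (suc m)) (suc m) zero zero
  all∈ x rewrite cycleFrom-zigzagCycle m =
    subst (_∈ _) (inverseʳ ρ) (∈-tabulate⁺ {f = ρ ⟨$⟩ʳ_} (ρ ⟨$⟩ˡ x))
    where ρ = zigzagOrder (suc m)

zigzag₀ : ℕ → List ℕ
zigzag₀ n = tabulate (toℕ ∘ (zigzagOrder n ⟨$⟩ʳ_))

zigzag₀-< : ∀ n → All (_< n) (zigzag₀ n)
zigzag₀-< n = Allₚ.tabulate⁺ (λ t → toℕ<n (zigzagOrder n ⟨$⟩ʳ t))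

zigzag₀-suc : ∀ n → zigzag₀ (suc n) ≡ 0 ∷ map (n ∸_) (zigzag₀ n)
zigzag₀-suc n = cong (0 ∷_) (begin
  tabulate (λ t → suc (toℕ (opposite (ρ t))))  ≡⟨ tabulate-cong (λ t → suc-toℕ-opposite (ρ t)) ⟩
  tabulate (λ t → n ∸ toℕ (ρ t))               ≡⟨ map-tabulate (toℕ ∘ ρ) (n ∸_) ⟨
  map (n ∸_) (zigzag₀ n)                        ∎)
  where
  open ≡-Reasoning
  ρ = zigzagOrder n ⟨$⟩ʳ_
  suc-toℕ-opposite : (i : Fin n) → suc (toℕ (opposite i)) ≡ n ∸ toℕ i
  suc-toℕ-opposite i = trans (cong suc (opposite-prop i)) (sym (+-∸-assoc 1 (toℕ<n i)))

suc-+-pred-∸ : ∀ lo {k y} → y < k → suc lo + (k ∸ 1 ∸ y) ≡ lo + (k ∸ y)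
suc-+-pred-∸ lo {suc k} {y} (s≤s y≤k) =
  trans (sym (+-suc lo (k ∸ y))) (cong (lo +_) (sym (+-∸-assoc 1 y≤k)))

mutual
  zig-zigzag₀ : ∀ k lo → zig k lo (lo + k ∸ 1) ≡ map (lo +_) (zigzag₀ k)
  zig-zigzag₀ zero    lo = refl
  zig-zigzag₀ (suc k) lo = begin
    lo ∷ zag k (suc lo) (lo + suc k ∸ 1)
      ≡⟨ cong (λ h → lo ∷ zag k (suc lo) (h ∸ 1)) (+-suc lo k) ⟩
    lo ∷ zag k (suc lo) (suc lo + k ∸ 1)
      ≡⟨ cong (lo ∷_) (zag-zigzag₀ k (suc lo)) ⟩
    lo ∷ map (λ y → suc lo + (k ∸ 1 ∸ y)) (zigzag₀ k)
      ≡⟨ cong₂ _∷_ (sym (+-identityʳ lo))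
                   (map-cong-local (All.map (suc-+-pred-∸ lo) (zigzag₀-< k))) ⟩
    lo + 0 ∷ map (λ y → lo + (k ∸ y)) (zigzag₀ k)
      ≡⟨ cong (lo + 0 ∷_) (map-∘ (zigzag₀ k)) ⟩
    map (lo +_) (0 ∷ map (k ∸_) (zigzag₀ k))
      ≡⟨ cong (map (lo +_)) (zigzag₀-suc k) ⟨
    map (lo +_) (zigzag₀ (suc k)) ∎
    where open ≡-Reasoning

  zag-zigzag₀ : ∀ k lo → zag k lo (lo + k ∸ 1) ≡ map (λ y → lo + (k ∸ 1 ∸ y)) (zigzag₀ k)
  zag-zigzag₀ zero    lo = refl
  zag-zigzag₀ (suc k) lo = begin
    (lo + suc k ∸ 1) ∷ zig k lo (lo + suc k ∸ 1 ∸ 1)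
      ≡⟨ cong (λ h → (h ∸ 1) ∷ zig k lo (h ∸ 1 ∸ 1)) (+-suc lo k) ⟩
    lo + k ∷ zig k lo (lo + k ∸ 1)
      ≡⟨ cong (lo + k ∷_) (zig-zigzag₀ k lo) ⟩
    lo + k ∷ map (lo +_) (zigzag₀ k)
      ≡⟨ cong (lo + k ∷_) (map-cong-local
           (All.map (λ y<k → cong (lo +_) (sym (m∸[m∸n]≡n (<⇒≤ y<k)))) (zigzag₀-< k))) ⟩
    lo + k ∷ map (λ y → lo + (k ∸ (k ∸ y))) (zigzag₀ k)
      ≡⟨ cong (lo + k ∷_) (map-∘ (zigzag₀ k)) ⟩
    map (λ y → lo + (k ∸ y)) (0 ∷ map (k ∸_) (zigzag₀ k))
      ≡⟨ cong (map (λ y → lo + (k ∸ y))) (zigzag₀-suc k) ⟨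
    map (λ y → lo + (k ∸ y)) (zigzag₀ (suc k)) ∎
    where open ≡-Reasoning

Flatten-zigzagCycle : ∀ n → Flatten (zigzagCycle n) ≡ zigzag n
Flatten-zigzagCycle n = begin
  map (λ i → suc (toℕ i)) (flattenFin (zigzagCycle n)) ≡⟨ cong (map _) (flattenFin-zigzagCycle n) ⟩
  map (λ i → suc (toℕ i)) (tabulate ρ)                 ≡⟨ map-tabulate ρ _ ⟩
  tabulate (suc ∘ toℕ ∘ ρ)                             ≡⟨ map-tabulate (toℕ ∘ ρ) suc ⟨
  map suc (zigzag₀ n)                                  ≡⟨ zig-zigzag₀ n 1 ⟨
  zigzag n                                             ∎
  where
  open ≡-Reasoning
  ρ = zigzagOrder n ⟨$⟩ʳ_

occ13-2-Flatten-≤ : ∀ {n} (σ : Permutation′ n) → occ13-2 (Flatten σ) ≤ maxOcc n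
occ13-2-Flatten-≤ σ = ≤-trans (occ13-2-≤-maxOcc (Flatten σ)) (maxOcc-mono (Flatten-length-≤ σ))

1≤maxOcc⇒1≤n : ∀ {n} → 1 ≤ maxOcc n → 1 ≤ n
1≤maxOcc⇒1≤n {zero}  ()
1≤maxOcc⇒1≤n {suc n} _ = s≤s z≤n

lemma3p1 : (n : ℕ) →
    IsFlattened n (zigzag n)
    × ((σ : Permutation′ n) → occ13-2 (Flatten σ) ≤ occ13-2 (zigzag n))
    × ((w : List ℕ) (r : ℕ) → IsFlattened n w → occ13-2 w ≡ r → 1 ≤ r →
         1 ≤ n × 4 * r ≤ (n ∸ 1) * (n ∸ 1))
lemma3p1 n = (zigzagCycle n , Flatten-zigzagCycle n) , zigzag-maximal , length-bound
  where
  zigzag-maximal : (σ : Permutation′ n) → occ13-2 (Flatten σ) ≤ occ13-2 (zigzag n)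
  zigzag-maximal σ = subst (occ13-2 (Flatten σ) ≤_) (sym (occ13-2-zigzag n)) (occ13-2-Flatten-≤ σ)

  length-bound : (w : List ℕ) (r : ℕ) → IsFlattened n w → occ13-2 w ≡ r → 1 ≤ r →
    1 ≤ n × 4 * r ≤ (n ∸ 1) * (n ∸ 1)
  length-bound w r (σ , refl) refl 1≤r =
    1≤maxOcc⇒1≤n (≤-trans 1≤r (occ13-2-Flatten-≤ σ)) ,
    ≤-trans (*-monoʳ-≤ 4 (occ13-2-Flatten-≤ σ)) (maxOcc-≤-quarterSquare n)
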